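{- Let $G$ be a $1$-perfectly orientable graph and $D$ any $1$-perfect orientation of $G$. Then every chordless cycle of $G$ of length at least four is oriented cyclically in $D$, i.e. every vertex of the cycle has exactly one out-neighbor (in $D$) on the cycle.
   Context: All graphs are finite and simple. An orientation of a graph $G$ is $1$-perfect if for every vertex $v$, its out-neighborhood is a clique in $G$; $G$ is $1$-perfectly orientable if it admits a $1$-perfect orientation. -}

module Defs where

open import Data.Nat using (ℕ; zero; suc; _≤_)
open import Data.Fin using (Fin; zero; suc; fromℕ; inject₁)
open import Data.Product using (_×_; Σ; ∃; ∃-syntax; _,_)
open import Data.Sum using (_⊎_)
open import Data.Empty using (⊥)
open import Relation.Nullary using (¬_)
open import Relation.Binary.PropositionalEquality using (_≡_; _≢_)
open import Function.Definitions using (Injective)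

record Graph (n : ℕ) : Set₁ where
  field
    Adj   : Fin n → Fin n → Set
    irrefl : ∀ {u} → ¬ Adj u u
    sym   : ∀ {u v} → Adj u v → Adj v u
open Graph public

record Orientation {n : ℕ} (G : Graph n) : Set₁ where
  field
    Arc      : Fin n → Fin n → Set
    arc-edge : ∀ {u v} → Arc u v → Adj G u v
    edge-arc : ∀ {u v} → Adj G u v → Arc u v ⊎ Arc v u
    antisym  : ∀ {u v} → Arc u v → ¬ Arc v u
open Orientation public

OnePerfect : ∀ {n} {G : Graph n} → Orientation G → Set
OnePerfect {G = G} D = ∀ v x y → Arc D v x → Arc D v y → x ≢ y → Adj G x y

OnePerfectlyOrientable : ∀ {n} → Graph n → Set₁
OnePerfectlyOrientable G = Σ (Orientation G) OnePerfect

-- cyclic successor on Fin (suc m): i ↦ i+1 mod (m+1)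
next : ∀ {m} → Fin (suc m) → Fin (suc m)
next {zero} zero = zero
next {suc m} zero = suc zero
next {suc m} (suc i) with next {m} i
... | zero = zero
... | suc j = suc (suc j)

-- A chordless (induced) cycle of length k in G, given by its cyclic sequence of
-- distinct vertices c 0, …, c (k-1); here k = suc m.
record ChordlessCycle {n : ℕ} (G : Graph n) (m : ℕ) : Set where
  field
    vert      : Fin (suc m) → Fin n
    distinct  : Injective _≡_ _≡_ vert
    edges     : ∀ i → Adj G (vert i) (vert (next i))
    chordless : ∀ i j → Adj G (vert i) (vert j) → (j ≡ next i) ⊎ (i ≡ next j)
open ChordlessCycle public

CyclicallyOriented : ∀ {n m} {G : Graph n} → Orientation G → ChordlessCycle G m → Set
CyclicallyOriented {m = m} D C =
  ∀ (i : Fin (suc m)) → ∃[ j ] (Arc D (vert C i) (vert C j)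
                          × (∀ j′ → Arc D (vert C i) (vert C j′) → j′ ≡ j))

-- On a chordless cycle of length at least four, two out-neighbours of a vertex would
-- have to be adjacent, giving a triangle in the cycle; so every cycle vertex has at
-- most one out-neighbour on the cycle. Hence if c (i+1) → c i, the vertex c (i+1)
-- cannot also point to c (i+2), so c (i+2) → c (i+1): a backward arc propagates
-- all the way round. So each c i either points to c (i+1), or all arcs point
-- backwards and c i points to c (i-1).
module Submission where

open import Defs hiding (sym)
open import Data.Nat using (zero; suc; _≤_; _<_; _+_; z≤n; s≤s; s≤s⁻¹)
open import Data.Nat.GeneralisedArithmetic using (fold)
open import Data.Nat.Properties
  using (+-identityʳ; +-suc; +-cancelʳ-≡; +-mono-≤; +-monoʳ-<; n<1+n; ≤-refl;
         ≤-trans; m≤n+m; <-≤-trans; ≤-<-trans; <-irrefl; n≤1+n; m<m+n)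
open import Data.Fin using (Fin; zero; suc; toℕ; _≟_)
open import Data.Fin.Properties using (toℕ<n; toℕ-injective)
open import Data.Product using (_×_; _,_)
open import Data.Sum using (_⊎_; inj₁; inj₂)
open import Data.Empty using (⊥; ⊥-elim)
open import Relation.Nullary using (yes; no)
open import Relation.Binary.PropositionalEquality
  using (_≡_; _≢_; refl; sym; trans; cong; subst)

toℕ-next : ∀ {m} (i : Fin (suc m)) →
           toℕ (next i) ≡ suc (toℕ i) ⊎ (toℕ (next i) ≡ 0 × toℕ i ≡ m)
toℕ-next {zero}  zero = inj₂ (refl , refl)
toℕ-next {suc m} zero = inj₁ refl
toℕ-next {suc m} (suc i) with next {m} i | toℕ-next {m} i
... | zero  | inj₁ ()
... | zero  | inj₂ (_ , i≡m) = inj₂ (refl , cong suc i≡m)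
... | suc j | inj₁ j≡i = inj₁ (cong suc j≡i)
... | suc j | inj₂ (() , _)

toℕ-fold-next : ∀ {m} (i : Fin (suc m)) t → t ≤ suc m →
                toℕ (fold i next t) ≡ toℕ i + t ⊎ toℕ (fold i next t) + suc m ≡ toℕ i + t
toℕ-fold-next i zero _ = inj₁ (sym (+-identityʳ (toℕ i)))
toℕ-fold-next {m} i (suc t) t<1+m
  with toℕ-fold-next i t (≤-trans (n≤1+n t) t<1+m) | toℕ-next (fold i next t)
... | inj₁ e | inj₁ e′ = inj₁ (trans e′ (trans (cong suc e) (sym (+-suc (toℕ i) t))))
... | inj₁ e | inj₂ (e₀ , eₘ) =
  inj₂ (trans (cong (_+ suc m) e₀) (trans (cong suc (trans (sym eₘ) e)) (sym (+-suc (toℕ i) t))))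
... | inj₂ e | inj₁ e′ =
  inj₂ (trans (cong (_+ suc m) e′) (trans (cong suc e) (sym (+-suc (toℕ i) t))))
... | inj₂ e | inj₂ (_ , eₘ) = ⊥-elim (<-irrefl (trans (sym e) (cong (_+ suc m) eₘ)) i+t<m+1+m)
  where
  i+t<m+1+m : toℕ i + t < m + suc m
  i+t<m+1+m = ≤-<-trans (+-mono-≤ (s≤s⁻¹ (toℕ<n i)) (s≤s⁻¹ t<1+m)) (+-monoʳ-< m (n<1+n m))

fold-next-period : ∀ {m} (i : Fin (suc m)) → fold i next (suc m) ≡ i
fold-next-period {m} i with toℕ-fold-next i (suc m) ≤-refl
... | inj₁ e = ⊥-elim (<-irrefl e (<-≤-trans (toℕ<n _) (m≤n+m (suc m) (toℕ i))))
... | inj₂ e = toℕ-injective (+-cancelʳ-≡ (suc m) _ _ e)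

fold-next-aperiodic : ∀ {m} (i : Fin (suc m)) {t} → 0 < t → t ≤ m → fold i next t ≢ i
fold-next-aperiodic {m} i {t} 0<t t≤m fixed with toℕ-fold-next i t (≤-trans t≤m (n≤1+n m))
... | inj₁ e = <-irrefl (trans (cong toℕ (sym fixed)) e) (m<m+n (toℕ i) 0<t)
... | inj₂ e = <-irrefl (trans (sym e) (cong (λ j → toℕ j + suc m) fixed))
                       (+-monoʳ-< (toℕ i) (s≤s t≤m))

infix 4 _—_
_—_ : ∀ {m} → Fin (suc m) → Fin (suc m) → Set
i — j = j ≡ next i ⊎ i ≡ next j

—-sym : ∀ {m} {i j : Fin (suc m)} → i — j → j — i
—-sym (inj₁ e) = inj₂ e
—-sym (inj₂ e) = inj₁ e

—-irrefl : ∀ {m} → 1 ≤ m → {i : Fin (suc m)} → i — i → ⊥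
—-irrefl 1≤m (inj₁ e) = fold-next-aperiodic _ (s≤s z≤n) 1≤m (sym e)
—-irrefl 1≤m (inj₂ e) = fold-next-aperiodic _ (s≤s z≤n) 1≤m (sym e)

—-common-successor : ∀ {m} → 1 ≤ m → {x y z : Fin (suc m)} →
                     y ≡ next x → z ≡ next x → y — z → ⊥
—-common-successor 1≤m refl refl = —-irrefl 1≤m

-- A non-cyclic orientation of a triangle has a source, whose two successors coincide.
—-triangle-free : ∀ {m} → 3 ≤ m → {i j k : Fin (suc m)} → i — j → j — k → k — i → ⊥
—-triangle-free {m} 3≤m = triangle
  where
  1≤m : 1 ≤ m
  1≤m = ≤-trans (s≤s z≤n) 3≤m

  triangle : {i j k : Fin (suc m)} → i — j → j — k → k — i → ⊥
  triangle (inj₁ refl) (inj₁ refl) (inj₁ ki) = fold-next-aperiodic _ (s≤s z≤n) 3≤m (sym ki)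
  triangle (inj₂ refl) (inj₂ refl) (inj₂ ki) = fold-next-aperiodic _ (s≤s z≤n) 3≤m (sym ki)
  triangle (inj₁ ij) jk         (inj₂ ik) = —-common-successor 1≤m ij ik jk
  triangle (inj₁ ij) (inj₂ kj) (inj₁ ki) = —-common-successor 1≤m kj ki (—-sym (inj₁ ij))
  triangle (inj₂ ji) (inj₂ kj) (inj₁ ki) = —-common-successor 1≤m kj ki (—-sym (inj₂ ji))
  triangle (inj₂ ji) (inj₁ jk) ki        = —-common-successor 1≤m ji jk (—-sym ki)

module _ {n} {G : Graph n} (D : Orientation G) (one-perfect : OnePerfect D)
         {m} (C : ChordlessCycle G m) (3≤m : 3 ≤ m) where

  private
    _⇒_ : Fin (suc m) → Fin (suc m) → Set
    i ⇒ j = Arc D (vert C i) (vert C j)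

  out-neighbour-unique : ∀ {i j k} → i ⇒ j → i ⇒ k → j ≡ k
  out-neighbour-unique {i} {j} {k} i⇒j i⇒k with j ≟ k
  ... | yes j≡k = j≡k
  ... | no j≢k = ⊥-elim (—-triangle-free 3≤m (chordless C i j (arc-edge D i⇒j)) j—k
                                              (—-sym (chordless C i k (arc-edge D i⇒k))))
    where
    j—k : j — k
    j—k = chordless C j k (one-perfect _ _ _ i⇒j i⇒k (λ e → j≢k (distinct C e)))

  backward-arc-propagates : ∀ j → next j ⇒ j → next (next j) ⇒ next j
  backward-arc-propagates j next-j⇒j with edge-arc D (edges C (next j))
  ... | inj₂ next²-j⇒next-j = next²-j⇒next-j
  ... | inj₁ next-j⇒next²-j = ⊥-elim (fold-next-aperiodic j (s≤s z≤n) (≤-trans (s≤s (s≤s z≤n)) 3≤m)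
                                        (sym (out-neighbour-unique next-j⇒j next-j⇒next²-j)))

  backward-arcs-everywhere : ∀ i → next i ⇒ i → ∀ t → next (fold i next t) ⇒ fold i next t
  backward-arcs-everywhere i next-i⇒i zero    = next-i⇒i
  backward-arcs-everywhere i next-i⇒i (suc t) =
    backward-arc-propagates _ (backward-arcs-everywhere i next-i⇒i t)

  cyclically-oriented : CyclicallyOriented D C
  cyclically-oriented i with edge-arc D (edges C i)
  ... | inj₁ i⇒next-i = next i , i⇒next-i , λ _ i⇒j → out-neighbour-unique i⇒j i⇒next-i
  ... | inj₂ next-i⇒i = fold i next m , i⇒prev-i , λ _ i⇒j → out-neighbour-unique i⇒j i⇒prev-i
    where
    i⇒prev-i : i ⇒ fold i next m
    i⇒prev-i = subst (_⇒ fold i next m) (fold-next-period i) (backward-arcs-everywhere i next-i⇒i m)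

-- The hypothesis that G is 1-perfectly orientable is witnessed by D itself.
lemma8 : ∀ {n} (G : Graph n) → OnePerfectlyOrientable G →
    (D : Orientation G) → OnePerfect D →
    ∀ {m} (C : ChordlessCycle G m) → 4 ≤ suc m → CyclicallyOriented D C
lemma8 G _ D one-perfect C 4≤1+m = cyclically-oriented D one-perfect C (s≤s⁻¹ 4≤1+m)
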